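{- Let $\mathsf{M}$ be an HMS model. For every individual $i\in I$ and any $\Upsilon\subseteq\Psi\subseteq\Phi\subseteq\mathsf{At}$, if $\omega\in S_\Phi$ and $\Pi_i(\omega)\subseteq S_\Upsilon$, then $\Pi_i(\omega_\Psi)=\Pi_i(\omega)$.
   Context: Fix a non-empty set $\mathsf{At}$. An HMS model $\langle I,\{S_\Phi\}_{\Phi\subseteq\mathsf{At}},(r^\Phi_\Psi),(\Pi_i)_{i\in I},v\rangle$: $I\ne\emptyset$; non-empty pairwise disjoint state spaces $S_\Phi$, ordered $S_{\Phi'}\succeq S_\Phi$ iff $\Phi\subseteq\Phi'$; $\Omega=\bigcup_\Phi S_\Phi$; surjections $r^\Phi_\Psi:S_\Phi\to S_\Psi$ ($\Psi\subseteq\Phi$), $r^\Phi_\Phi=\mathrm{id}$, $r^\Phi_\Upsilon=r^\Psi_\Upsilon\circ r^\Phi_\Psi$; for $\omega\in S_\Phi$, $\omega_\Psi:=r^\Phi_\Psi(\omega)$; for $D\subseteq S_\Phi$, $D_\Upsilon:=r^\Phi_\Upsilon(D)$ and $D^\uparrow:=\bigcup_{\Phi\subseteq\Psi}(r^\Psi_\Phi)^{ -1}(D)$; events are sets $D^\uparrow$ with base-space $S_\Phi$; $v$ maps atoms to events. Each $\Pi_i:\Omega\to2^\Omega\setminus\{\emptyset\}$ satisfies: Confinement ($\omega\in S_\Phi\Rightarrow\Pi_i(\omega)\subseteq S_\Psi$ for some $\Psi\subseteq\Phi$); Generalized Reflexivity ($\omega\in\Pi_i(\omega)^\uparrow$);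 Stationarity ($\omega'\in\Pi_i(\omega)\Rightarrow\Pi_i(\omega')=\Pi_i(\omega)$); Projections Preserve Ignorance ($\omega\in S_\Phi$, $\Psi\subseteq\Phi\Rightarrow\Pi_i(\omega)^\uparrow\subseteq\Pi_i(\omega_\Psi)^\uparrow$); Projections Preserve Knowledge ($\Upsilon\subseteq\Psi\subseteq\Phi$, $\omega\in S_\Phi$, $\Pi_i(\omega)\subseteq S_\Psi\Rightarrow(\Pi_i(\omega))_\Upsilon=\Pi_i(\omega_\Upsilon)$). -}

module Defs where

open import Level using (0ℓ)
open import Data.Product using (Σ; ∃; _×_; _,_)
open import Relation.Unary using (Pred; _⊆_; _∈_)
open import Relation.Binary.PropositionalEquality using (_≡_)

Sub : Set → Set₁
Sub At = Pred At 0ℓ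

_≐_ : ∀ {A : Set} → Pred A 0ℓ → Pred A 0ℓ → Set
P ≐ Q = (P ⊆ Q) × (Q ⊆ P)

infix 4 _≐_

-- An HMS model over the atoms At.
-- Ω is the disjoint union of all state spaces; lev ω is the Φ with ω ∈ S_Φ,
-- so S_Φ = { ω | lev ω = Φ } (set equality), which makes the state spaces
-- pairwise disjoint by construction.  proj ω Ψ is ω_Ψ = r^Φ_Ψ(ω)
-- (only meaningful when Ψ ⊆ lev ω).
record HMS (At : Set) : Set₁ where
  field
    I      : Set
    I-ne   : I
    Ω      : Set
    lev    : Ω → Sub At

  S : Sub At → Pred Ω 0ℓ
  S Φ ω = lev ω ≐ Φ

  field
    S-ne      : ∀ Φ → Σ Ω (S Φ)
    proj      : Ω → Sub At → Ω
    -- projections are indexed by subsets, so respect set equality of the index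
    proj-resp : ∀ ω {Ψ Ψ'} → Ψ ≐ Ψ' → proj ω Ψ ≡ proj ω Ψ'
    proj-lev  : ∀ ω Ψ → Ψ ⊆ lev ω → S Ψ (proj ω Ψ)
    proj-id   : ∀ ω → proj ω (lev ω) ≡ ω
    proj-comp : ∀ ω Ψ Υ → Υ ⊆ Ψ → Ψ ⊆ lev ω → proj (proj ω Ψ) Υ ≡ proj ω Υ
    proj-surj : ∀ Φ Ψ → Ψ ⊆ Φ → ∀ ω' → S Ψ ω' → Σ Ω λ ω → S Φ ω × proj ω Ψ ≡ ω'

  -- For non-empty D ⊆ S_Φ this is exactly
  -- ⋃_{Φ ⊆ Ψ} (r^Ψ_Φ)⁻¹(D); for D = ∅ both sides are ∅.
  up : Pred Ω 0ℓ → Pred Ω 0ℓ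
  up D ω' = Σ Ω λ ω'' → ω'' ∈ D × (lev ω'' ⊆ lev ω') × (proj ω' (lev ω'') ≡ ω'')

  img : Pred Ω 0ℓ → Sub At → Pred Ω 0ℓ
  img D Υ x = Σ Ω λ y → y ∈ D × (proj y Υ ≡ x)

  field
    v      : At → Pred Ω 0ℓ
    v-ev   : ∀ a → Σ (Sub At) λ Φ → Σ (Pred Ω 0ℓ) λ D → (D ⊆ S Φ) × (v a ≐ up D)
    Π      : I → Ω → Pred Ω 0ℓ
    Π-ne   : ∀ i ω → Σ Ω (Π i ω)
    confinement : ∀ i ω → Σ (Sub At) λ Ψ → (Ψ ⊆ lev ω) × (Π i ω ⊆ S Ψ)
    gen-refl    : ∀ i ω → ω ∈ up (Π i ω)
    stationarity : ∀ i ω ω' → ω' ∈ Π i ω → Π i ω' ≐ Π i ω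
    ppi : ∀ i ω Ψ → Ψ ⊆ lev ω → up (Π i ω) ⊆ up (Π i (proj ω Ψ))
    ppk : ∀ i ω Ψ Υ → Υ ⊆ Ψ → Ψ ⊆ lev ω → Π i ω ⊆ S Ψ →
          img (Π i ω) Υ ≐ Π i (proj ω Υ)

-- If ω's possibility set lives at level Υ, knowledge of Υ is all that ω carries, so by
-- Projections Preserve Knowledge Π(ω_Υ) = Π(ω).  For Υ ⊆ Ψ it remains to see that
-- Π(ω_Ψ) also lives at level Υ; then the same fact at ω_Ψ gives Π(ω_Ψ) = Π(ω_Υ) = Π(ω).
-- That level is squeezed by Projections Preserve Ignorance: projecting ω_Ψ down to Υ
-- shows it is at least Υ, and projecting ω down to Ψ shows it is at most Υ.
module Submission where

open import Defs
open import Relation.Unary using (Pred; _⊆_; _∈_)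
open import Relation.Unary.Properties using (≐-sym; ≐-trans)
open import Level using (0ℓ)
open import Data.Product using (_,_; proj₁; proj₂)
open import Function using (id)
open import Relation.Binary.PropositionalEquality using (_≡_; sym; trans; subst)

module Properties {At : Set} (M : HMS At) where
  open HMS M

  proj-of-S : ∀ {y Υ} → S Υ y → proj y Υ ≡ y
  proj-of-S {y} y∈SΥ = trans (sym (proj-resp y y∈SΥ)) (proj-id y)

  ⊆-up : (D : Pred Ω 0ℓ) → D ⊆ up D
  ⊆-up D {x} x∈D = x , x∈D , id , proj-id x

  up-lev : ∀ {D Υ x} → D ⊆ S Υ → x ∈ up D → Υ ⊆ lev x
  up-lev D⊆SΥ (_ , y∈D , y≤x , _) p = y≤x (proj₂ (D⊆SΥ y∈D) p)

  Π-lev-unique : ∀ i ω {x y} → x ∈ Π i ω → y ∈ Π i ω → lev x ⊆ lev y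
  Π-lev-unique i ω x∈Π y∈Π p = proj₂ (Π⊆SΨ y∈Π) (proj₁ (Π⊆SΨ x∈Π) p)
    where Π⊆SΨ = proj₂ (proj₂ (confinement i ω))

  Π-proj-confined : ∀ i ω {Υ} → Υ ⊆ lev ω → Π i ω ⊆ S Υ → Π i (proj ω Υ) ≐ Π i ω
  Π-proj-confined i ω {Υ} Υ⊆ω Π⊆SΥ = Π-ωΥ⊆Π-ω , Π-ω⊆Π-ωΥ
    where
    img≐Π = ppk i ω Υ Υ id Υ⊆ω Π⊆SΥ

    Π-ωΥ⊆Π-ω : Π i (proj ω Υ) ⊆ Π i ω
    Π-ωΥ⊆Π-ω x∈Π with proj₂ img≐Π x∈Π
    ... | y , y∈Π , y↦x = subst (Π i ω) (trans (sym (proj-of-S (Π⊆SΥ y∈Π))) y↦x) y∈Π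

    Π-ω⊆Π-ωΥ : Π i ω ⊆ Π i (proj ω Υ)
    Π-ω⊆Π-ωΥ {x} x∈Π = proj₁ img≐Π (x , x∈Π , proj-of-S (Π⊆SΥ x∈Π))

  Π-proj-confined-above : ∀ i ω {Υ Ψ} → Υ ⊆ Ψ → Ψ ⊆ lev ω → Π i ω ⊆ S Υ →
                          Π i (proj ω Ψ) ⊆ S Υ
  Π-proj-confined-above i ω {Υ} {Ψ} Υ⊆Ψ Ψ⊆ω Π⊆SΥ {x} x∈Π = lev-x⊆Υ , Υ⊆lev-x
    where
    ω' = proj ω Ψ
    Υ⊆ω' : Υ ⊆ lev ω'
    Υ⊆ω' p = proj₂ (proj-lev ω Ψ Ψ⊆ω) (Υ⊆Ψ p)

    Π-ω'Υ≐Π-ω : Π i (proj ω' Υ) ≐ Π i ω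
    Π-ω'Υ≐Π-ω = subst (λ u → Π i u ≐ Π i ω) (sym (proj-comp ω Ψ Υ Υ⊆Ψ Ψ⊆ω))
                      (Π-proj-confined i ω (λ p → Ψ⊆ω (Υ⊆Ψ p)) Π⊆SΥ)

    Υ⊆lev-x : Υ ⊆ lev x
    Υ⊆lev-x = up-lev (λ z∈Π → Π⊆SΥ (proj₁ Π-ω'Υ≐Π-ω z∈Π))
                     (ppi i ω' Υ Υ⊆ω' (⊆-up (Π i ω') x∈Π))

    lev-x⊆Υ : lev x ⊆ Υ
    lev-x⊆Υ with Π-ne i ω
    ... | y , y∈Π with ppi i ω Ψ Ψ⊆ω (⊆-up (Π i ω) y∈Π)
    ... | w , w∈Π , w≤y , _ =
      λ p → proj₁ (Π⊆SΥ y∈Π) (w≤y (Π-lev-unique i ω' x∈Π w∈Π p))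

lemma2 : (At : Set) → At → (M : HMS At) →
         let open HMS M in
         ∀ (i : I) (Υ Ψ Φ : Sub At) → Υ ⊆ Ψ → Ψ ⊆ Φ →
         ∀ (ω : Ω) → S Φ ω → Π i ω ⊆ S Υ →
         Π i (proj ω Ψ) ≐ Π i ω
lemma2 At _ M i Υ Ψ Φ Υ⊆Ψ Ψ⊆Φ ω ω∈SΦ Π⊆SΥ =
  ≐-trans (≐-sym Π-ωΥ≐Π-ω') Π-ωΥ≐Π-ω
  where
  open HMS M
  open Properties M

  Ψ⊆ω : Ψ ⊆ lev ω
  Ψ⊆ω p = proj₂ ω∈SΦ (Ψ⊆Φ p)

  ω' = proj ω Ψ

  Π-ωΥ≐Π-ω' : Π i (proj ω Υ) ≐ Π i ω'
  Π-ωΥ≐Π-ω' =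
    subst (λ u → Π i u ≐ Π i ω') (proj-comp ω Ψ Υ Υ⊆Ψ Ψ⊆ω)
          (Π-proj-confined i ω' (λ p → proj₂ (proj-lev ω Ψ Ψ⊆ω) (Υ⊆Ψ p))
                           (Π-proj-confined-above i ω Υ⊆Ψ Ψ⊆ω Π⊆SΥ))

  Π-ωΥ≐Π-ω : Π i (proj ω Υ) ≐ Π i ω
  Π-ωΥ≐Π-ω = Π-proj-confined i ω (λ p → Ψ⊆ω (Υ⊆Ψ p)) Π⊆SΥ
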